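{- There exists an additive $(52,4,1)$-design that is both $1$-rotational and resolvable.
   Context: A $(v,k,1)$-design is a pair $(V,\mathcal{B})$ with $V$ a $v$-set and $\mathcal{B}$ a collection of $k$-subsets (blocks) such that every pair of distinct points lies in exactly one block. A design is additive if, for some abelian group $G$, up to isomorphism its points are elements of $G$ and every block is zero-sum in $G$. An automorphism of a design is a permutation of $V$ leaving $\mathcal{B}$ invariant; the design is $1$-rotational if it has an automorphism fixing one point and cyclically permuting all the others. A design is resolvable if $\mathcal{B}$ can be partitioned into classes each of which is a partition of $V$. -}

module Defs where

open import Level using (0ℓ)
open import Data.Nat using (ℕ; zero; suc)
open import Data.Fin using (Fin; zero; suc)
open import Data.Fin.Subset using (Subset; _∈_; ∣_∣)
open import Data.Fin.Permutation using (Permutation′; _⟨$⟩ʳ_)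
open import Data.Vec using ([]; _∷_)
open import Data.Bool using (true; false)
open import Data.Product using (Σ; _×_; ∃; ∃-syntax)
open import Relation.Binary.PropositionalEquality using (_≡_; _≢_)
open import Algebra.Bundles using (AbelianGroup)

∃! : {b : ℕ} → (Fin b → Set) → Set
∃! {b} P = Σ (Fin b) λ i → P i × (∀ j → P j → j ≡ i)

record Design (v k : ℕ) : Set where
  field
    b       : ℕ
    block   : Fin b → Subset v
    blockSz : ∀ i → ∣ block i ∣ ≡ k
    pairs   : ∀ (x y : Fin v) → x ≢ y → ∃! (λ i → (x ∈ block i) × (y ∈ block i))

open Design public

sumSub : ∀ (G : AbelianGroup 0ℓ 0ℓ) {n : ℕ} → Subset n →
         (Fin n → AbelianGroup.Carrier G) → AbelianGroup.Carrier G
sumSub G []            f = AbelianGroup.ε G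
sumSub G (true  ∷ s) f = AbelianGroup._∙_ G (f zero) (sumSub G s (λ x → f (suc x)))
sumSub G (false ∷ s) f = sumSub G s (λ x → f (suc x))

Additive : ∀ {v k} → Design v k → Set₁
Additive {v} D = Σ (AbelianGroup 0ℓ 0ℓ) λ G →
  Σ (Fin v → AbelianGroup.Carrier G) λ f →
    (∀ x y → AbelianGroup._≈_ G (f x) (f y) → x ≡ y) ×
    (∀ i → AbelianGroup._≈_ G (sumSub G (block D i) f) (AbelianGroup.ε G))

IsAutomorphism : ∀ {v k} (D : Design v k) → Permutation′ v → Set
IsAutomorphism D π = Σ (Permutation′ (b D)) λ σ →
  ∀ i x → (x ∈ block D i → (π ⟨$⟩ʳ x) ∈ block D (σ ⟨$⟩ʳ i)) ×
          ((π ⟨$⟩ʳ x) ∈ block D (σ ⟨$⟩ʳ i) → x ∈ block D i)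

iter : ∀ {v} → Permutation′ v → ℕ → Fin v → Fin v
iter π zero    x = x
iter π (suc n) x = π ⟨$⟩ʳ iter π n x

FixesOneCyclesRest : ∀ {v} → Permutation′ v → Set
FixesOneCyclesRest {v} π = Σ (Fin v) λ ∞ → (π ⟨$⟩ʳ ∞ ≡ ∞) ×
  Σ (Fin v) λ x₀ → (x₀ ≢ ∞) × (∀ y → y ≢ ∞ → ∃[ n ] iter π n x₀ ≡ y)

OneRotational : ∀ {v k} → Design v k → Set
OneRotational {v} D = Σ (Permutation′ v) λ π → IsAutomorphism D π × FixesOneCyclesRest π

Resolvable : ∀ {v k} → Design v k → Set
Resolvable {v} D = Σ ℕ λ r → Σ (Fin (b D) → Fin r) λ c →
  ∀ (j : Fin r) (x : Fin v) → ∃! (λ i → (c i ≡ j) × (x ∈ block D i))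

-- Points are ℤ₅₁ ∪ {∞}. The blocks are the development under x ↦ x + 1 of the short base
-- block {∞, 0, 17, 34}, whose orbit has length 17, and of four base blocks whose 48 differences
-- cover ℤ₅₁ ∖ {0, 17, 34} exactly once. Translation is an automorphism fixing ∞ and transitive
-- on ℤ₅₁, so it suffices that every pair through 0 lies in exactly one block. The blocks
-- B + s with 17 ∣ s form a parallel class, and its 17 translates resolve the design; by the same
-- transitivity it suffices to check that one class partitions the points. Additivity is
-- witnessed by an explicit injection into ℤ₂⁸ under which every block sums to zero.

module Submission where

open import Defs
open import Algebra.Bundles using (AbelianGroup; CommutativeRing)
open import Algebra.Structures using (IsAbelianGroup)
open import Data.Bool using (Bool; false)
open import Data.Bool.Properties using (xor-∧-commutativeRing) renaming (_≟_ to _≟ᵇ_)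
open import Data.Empty using (⊥-elim)
open import Data.Fin using (Fin; zero; suc; toℕ; fromℕ; _↑ˡ_; splitAt)
open import Data.Fin.Permutation
  using (Permutation′; permutation; _⟨$⟩ʳ_; _⟨$⟩ˡ_; flip; inverseˡ; inverseʳ)
open import Data.Fin.Properties
  using (_≟_; all?; toℕ-injective; toℕ-fromℕ<; fromℕ<-toℕ; fromℕ<-cong; toℕ<n; +↔⊎; *↔×; splitAt-↑ˡ)
open import Data.Fin.Subset using (Subset; _∈_; ⁅_⁆; ⋃; ∣_∣)
open import Data.Fin.Subset.Properties
  using (x∈⁅x⁆; x∈⁅y⁆⇒x≡y; ∉⊥; x∈p∪q⁺; x∈p∪q⁻) renaming (_∈?_ to _∈ₛ?_)
open import Data.List using (List; []; _∷_; map; allFin; concatMap; find)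
open import Data.List.Membership.Propositional using () renaming (_∈_ to _∈ₗ_)
open import Data.List.Membership.DecPropositional (_≟_ {52}) using () renaming (_∈?_ to _∈ₗ?_)
open import Data.List.Membership.Propositional.Properties using (∈-map⁺; ∈-map⁻)
open import Data.List.Properties using (map-∘; map-cong)
open import Data.List.Relation.Binary.Subset.DecPropositional (_≟_ {52}) using (_⊆_; _⊆?_)
open import Data.List.Relation.Binary.Subset.Propositional.Properties using (⊆-reflexive)
open import Data.List.Relation.Unary.Any using (here; there)
open import Data.Maybe using (fromMaybe)
open import Data.Nat using (ℕ; zero; suc; _+_; _∸_; NonZero)
import Data.Nat as ℕ
open import Data.Nat.Divisibility using (divides)
open import Data.Nat.DivMod
  using (_%_; _/_; _mod_; %-distribˡ-+; m%n%n≡m%n; [m+n]%n≡m%n; m<n⇒m%n≡m; m%n<n; m∣n⇒o%n%m≡o%m)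
open import Data.Nat.Properties using (+-suc; +-comm)
open import Data.Product using (Σ; ∃-syntax; _×_; _,_; proj₁; proj₂)
open import Data.Product.Function.NonDependent.Propositional using (_×-↔_)
open import Data.Sum using (_⊎_; inj₁; inj₂; [_,_]′)
open import Data.Sum.Function.Propositional using (_⊎-↔_)
open import Data.Vec using (Vec; []; _∷_; lookup; zipWith; replicate)
import Data.Vec as Vec
open import Data.Vec.Properties
  using (zipWith-assoc; zipWith-comm; zipWith-identityˡ; zipWith-identityʳ; zipWith-inverseˡ; zipWith-inverseʳ)
  renaming (≡-dec to ≡-decᵛ)
open import Function using (_∘_; _↔_; Inverse; id)
open import Function.Properties.Inverse using (↔-refl; ↔-sym; ↔-trans)
open import Level using (0ℓ)
open import Relation.Binary.PropositionalEquality
  using (_≡_; _≢_; refl; sym; trans; cong; cong₂; subst; subst₂; isEquivalence; module ≡-Reasoning)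
open import Relation.Nullary using (Dec; yes; no; ¬?; _×-dec_; _→-dec_)
open import Relation.Nullary.Decidable using (True; toWitness)

decide : {P : Set} (P? : Dec P) → {True P?} → P
decide _ {p} = toWitness p

⟨$⟩ʳ-injective : ∀ {n} (π : Permutation′ n) {x y} → π ⟨$⟩ʳ x ≡ π ⟨$⟩ʳ y → x ≡ y
⟨$⟩ʳ-injective π eq = trans (sym (inverseˡ π)) (trans (cong (π ⟨$⟩ˡ_) eq) (inverseˡ π))

∃!-transport : ∀ {b} {P Q : Fin b → Set} (σ : Permutation′ b) →
               (∀ i → P i → Q (σ ⟨$⟩ʳ i)) → (∀ i → Q (σ ⟨$⟩ʳ i) → P i) → ∃! P → ∃! Q
∃!-transport {Q = Q} σ to from (i , p , unique) =
  σ ⟨$⟩ʳ i , to i p , λ j q →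
    trans (sym (inverseʳ σ)) (cong (σ ⟨$⟩ʳ_) (unique _ (from _ (subst Q (sym (inverseʳ σ)) q))))

iter-sucʳ : ∀ {v} (π : Permutation′ v) n x → iter π (suc n) x ≡ iter π n (π ⟨$⟩ʳ x)
iter-sucʳ π zero    x = refl
iter-sucʳ π (suc n) x = cong (π ⟨$⟩ʳ_) (iter-sucʳ π n x)

iter-flip : ∀ {v} (π : Permutation′ v) n x → iter π n (iter (flip π) n x) ≡ x
iter-flip π zero    x = refl
iter-flip π (suc n) x = begin
  iter π (suc n) (π ⟨$⟩ˡ iter (flip π) n x)    ≡⟨ iter-sucʳ π n _ ⟩
  iter π n (π ⟨$⟩ʳ (π ⟨$⟩ˡ iter (flip π) n x)) ≡⟨ cong (iter π n) (inverseʳ π) ⟩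
  iter π n (iter (flip π) n x)                  ≡⟨ iter-flip π n x ⟩
  x                                              ∎
  where open ≡-Reasoning

iter-fixed : ∀ {v} (π : Permutation′ v) {x} → π ⟨$⟩ʳ x ≡ x → ∀ n → iter π n x ≡ x
iter-fixed π fixed zero    = refl
iter-fixed π fixed (suc n) = trans (cong (π ⟨$⟩ʳ_) (iter-fixed π fixed n)) fixed

module BlockFamily {v b : ℕ} (B : Fin b → Subset v) where

  MapsBlocks : Permutation′ v → Permutation′ b → Set
  MapsBlocks π σ = ∀ i x → (x ∈ B i → π ⟨$⟩ʳ x ∈ B (σ ⟨$⟩ʳ i)) ×
                           (π ⟨$⟩ʳ x ∈ B (σ ⟨$⟩ʳ i) → x ∈ B i)

  UniqueLine : Fin v → Fin v → Set
  UniqueLine x y = ∃! λ i → x ∈ B i × y ∈ B i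

  UniqueInClass : ∀ {r} → (Fin b → Fin r) → Fin r → Fin v → Set
  UniqueInClass c j x = ∃! λ i → c i ≡ j × x ∈ B i

  uniqueLine-swap : ∀ {x y} → UniqueLine x y → UniqueLine y x
  uniqueLine-swap (i , (x∈ , y∈) , unique) = i , (y∈ , x∈) , λ j (y∈′ , x∈′) → unique j (x∈′ , y∈′)

  module _ (π : Permutation′ v) (σ : Permutation′ b) (aut : MapsBlocks π σ) where

    uniqueLine-map : ∀ {x y} → UniqueLine x y → UniqueLine (π ⟨$⟩ʳ x) (π ⟨$⟩ʳ y)
    uniqueLine-map {x} {y} = ∃!-transport σ
      (λ i (x∈ , y∈) → proj₁ (aut i x) x∈ , proj₁ (aut i y) y∈)
      (λ i (x∈ , y∈) → proj₂ (aut i x) x∈ , proj₂ (aut i y) y∈)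

    uniqueLine-iter : ∀ n {x y} → UniqueLine x y → UniqueLine (iter π n x) (iter π n y)
    uniqueLine-iter zero    = id
    uniqueLine-iter (suc n) = uniqueLine-map ∘ uniqueLine-iter n

    uniqueLines-from-base : ∀ ∞ x₀ → π ⟨$⟩ʳ ∞ ≡ ∞ → x₀ ≢ ∞ →
                            (∀ y → y ≢ ∞ → ∃[ n ] iter π n x₀ ≡ y) →
                            (∀ y → y ≢ x₀ → UniqueLine x₀ y) →
                            ∀ x y → x ≢ y → UniqueLine x y
    uniqueLines-from-base ∞ x₀ fixed x₀≢∞ orbit base x y x≢y with x ≟ ∞
    ... | yes refl =
      let (n , πⁿx₀≡y) = orbit y (x≢y ∘ sym)
      in subst₂ UniqueLine (iter-fixed π fixed n) πⁿx₀≡y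
           (uniqueLine-iter n (uniqueLine-swap (base ∞ (x₀≢∞ ∘ sym))))
    ... | no x≢∞ =
      let (n , πⁿx₀≡x) = orbit x x≢∞
          y₀ = iter (flip π) n y
          y₀≢x₀ : y₀ ≢ x₀
          y₀≢x₀ y₀≡x₀ = x≢y (trans (sym πⁿx₀≡x) (trans (cong (iter π n) (sym y₀≡x₀)) (iter-flip π n y)))
      in subst₂ UniqueLine πⁿx₀≡x (iter-flip π n y) (uniqueLine-iter n (base y₀ y₀≢x₀))

    module _ {r} (c : Fin b → Fin r) (ν : Permutation′ r)
             (equivariant : ∀ i → c (σ ⟨$⟩ʳ i) ≡ ν ⟨$⟩ʳ c i) where

      uniqueInClass-map : ∀ {j x} → UniqueInClass c j x → UniqueInClass c (ν ⟨$⟩ʳ j) (π ⟨$⟩ʳ x)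
      uniqueInClass-map {j} {x} = ∃!-transport σ
        (λ i (cᵢ≡j , x∈) → trans (equivariant i) (cong (ν ⟨$⟩ʳ_) cᵢ≡j) , proj₁ (aut i x) x∈)
        (λ i (cσᵢ≡νj , x∈) → ⟨$⟩ʳ-injective ν (trans (sym (equivariant i)) cσᵢ≡νj) , proj₂ (aut i x) x∈)

      uniqueInClass-iter : ∀ n {j x} → UniqueInClass c j x → UniqueInClass c (iter ν n j) (iter π n x)
      uniqueInClass-iter zero    = id
      uniqueInClass-iter (suc n) = uniqueInClass-map ∘ uniqueInClass-iter n

      uniqueInClasses-from-base : ∀ j₀ → (∀ j → ∃[ n ] iter ν n j₀ ≡ j) →
                                  (∀ x → UniqueInClass c j₀ x) → ∀ j x → UniqueInClass c j x
      uniqueInClasses-from-base j₀ orbit base j x =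
        let (n , νⁿj₀≡j) = orbit j
        in subst₂ (UniqueInClass c) νⁿj₀≡j (iter-flip π n x)
             (uniqueInClass-iter n (base (iter (flip π) n x)))

fromList : ∀ {n} → List (Fin n) → Subset n
fromList = ⋃ ∘ map ⁅_⁆

∈-fromList⁺ : ∀ {n} {x : Fin n} {xs} → x ∈ₗ xs → x ∈ fromList xs
∈-fromList⁺ (here refl)  = x∈p∪q⁺ (inj₁ (x∈⁅x⁆ _))
∈-fromList⁺ (there x∈xs) = x∈p∪q⁺ (inj₂ (∈-fromList⁺ x∈xs))

∈-fromList⁻ : ∀ {n} {x : Fin n} xs → x ∈ fromList xs → x ∈ₗ xs
∈-fromList⁻ []       x∈ = ⊥-elim (∉⊥ x∈)
∈-fromList⁻ (y ∷ ys) x∈ =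
  [ here ∘ x∈⁅y⁆⇒x≡y y , there ∘ ∈-fromList⁻ ys ]′ (x∈p∪q⁻ ⁅ y ⁆ (fromList ys) x∈)

%-absorbʳ : ∀ m n d .{{_ : NonZero d}} → (m + n % d) % d ≡ (m + n) % d
%-absorbʳ m n d = begin
  (m + n % d) % d         ≡⟨ %-distribˡ-+ m (n % d) d ⟩
  (m % d + n % d % d) % d ≡⟨ cong (λ k → (m % d + k) % d) (m%n%n≡m%n n d) ⟩
  (m % d + n % d) % d     ≡⟨ %-distribˡ-+ m n d ⟨
  (m + n) % d             ∎
  where open ≡-Reasoning

%-absorbˡ : ∀ m n d .{{_ : NonZero d}} → (m % d + n) % d ≡ (m + n) % d
%-absorbˡ m n d = begin
  (m % d + n) % d ≡⟨ cong (_% d) (+-comm (m % d) n) ⟩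
  (n + m % d) % d ≡⟨ %-absorbʳ n m d ⟩
  (n + m) % d     ≡⟨ cong (_% d) (+-comm n m) ⟩
  (m + n) % d     ∎
  where open ≡-Reasoning

mod-cong : ∀ m n d .{{_ : NonZero d}} → m % d ≡ n % d → m mod d ≡ n mod d
mod-cong m n d eq = toℕ-injective (trans (toℕ-fromℕ< _) (trans eq (sym (toℕ-fromℕ< _))))

toℕ-mod : ∀ {n} (x : Fin (suc n)) → toℕ x mod suc n ≡ x
toℕ-mod x = trans (fromℕ<-cong _ _ (m<n⇒m%n≡m (toℕ<n x)) _ (toℕ<n x)) (fromℕ<-toℕ x (toℕ<n x))

suc-toℕ-mod : ∀ m n .{{_ : NonZero n}} → suc (toℕ (m mod n)) mod n ≡ suc m mod n
suc-toℕ-mod m n =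
  mod-cong (suc (toℕ (m mod n))) (suc m) n (trans (cong (λ k → suc k % n) (toℕ-fromℕ< _)) (%-absorbʳ 1 m n))

rotate : ∀ n → Permutation′ (suc n)
rotate n = permutation next prev next∘prev prev∘next
  where
  m = suc n
  next prev : Fin m → Fin m
  next x = suc (toℕ x) mod m
  prev x = (toℕ x + n) mod m
  open ≡-Reasoning
  next∘prev : ∀ x → next (prev x) ≡ x
  next∘prev x = begin
    suc (toℕ ((toℕ x + n) mod m)) mod m ≡⟨ suc-toℕ-mod (toℕ x + n) m ⟩
    suc (toℕ x + n) mod m               ≡⟨ mod-cong (suc (toℕ x + n)) (toℕ x + m) m
                                                    (cong (_% m) (sym (+-suc (toℕ x) n))) ⟩
    (toℕ x + m) mod m                   ≡⟨ mod-cong (toℕ x + m) (toℕ x) m ([m+n]%n≡m%n (toℕ x) m) ⟩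
    toℕ x mod m                         ≡⟨ toℕ-mod x ⟩
    x                                   ∎
  prev∘next : ∀ x → prev (next x) ≡ x
  prev∘next x = begin
    (toℕ (suc (toℕ x) mod m) + n) mod m ≡⟨ mod-cong (toℕ (suc (toℕ x) mod m) + n) (toℕ x + m) m
                                             (trans (cong (λ k → (k + n) % m) (toℕ-fromℕ< (m%n<n (suc (toℕ x)) m)))
                                             (trans (%-absorbˡ (suc (toℕ x)) n m)
                                                    (cong (_% m) (sym (+-suc (toℕ x) n))))) ⟩
    (toℕ x + m) mod m                   ≡⟨ mod-cong (toℕ x + m) (toℕ x) m ([m+n]%n≡m%n (toℕ x) m) ⟩
    toℕ x mod m                         ≡⟨ toℕ-mod x ⟩
    x                                   ∎

iter-rotate : ∀ n k → iter (rotate n) k zero ≡ k mod suc n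
iter-rotate n zero    = refl
iter-rotate n (suc k) = trans (cong (rotate n ⟨$⟩ʳ_) (iter-rotate n k)) (suc-toℕ-mod k (suc n))

rotate-orbit : ∀ n (j : Fin (suc n)) → ∃[ k ] iter (rotate n) k zero ≡ j
rotate-orbit n j = toℕ j , trans (iter-rotate n (toℕ j)) (toℕ-mod j)

Point : Set
Point = Fin 52

∞ : Point
∞ = fromℕ 51

residue : ℕ → Point
residue n = (n mod 51) ↑ˡ 1

ρ : Permutation′ 52
ρ = ↔-trans +↔⊎ (↔-trans (rotate 50 ⊎-↔ ↔-refl) (↔-sym +↔⊎))

ρ-∞ : ρ ⟨$⟩ʳ ∞ ≡ ∞
ρ-∞ = refl

ρ-residue : ∀ n → ρ ⟨$⟩ʳ residue n ≡ residue (suc n)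
ρ-residue n rewrite splitAt-↑ˡ 51 (n mod 51) 1 = cong (_↑ˡ 1) (suc-toℕ-mod n 51)

iter-ρ-residue : ∀ n → iter ρ n (residue 0) ≡ residue n
iter-ρ-residue zero    = refl
iter-ρ-residue (suc n) = trans (cong (ρ ⟨$⟩ʳ_) (iter-ρ-residue n)) (ρ-residue n)

residue-toℕ : ∀ y → y ≢ ∞ → residue (toℕ y) ≡ y
residue-toℕ = decide (all? λ y → ¬? (y ≟ ∞) →-dec residue (toℕ y) ≟ y)

ρ-orbit : ∀ y → y ≢ ∞ → ∃[ n ] iter ρ n (residue 0) ≡ y
ρ-orbit y y≢∞ = toℕ y , trans (iter-ρ-residue (toℕ y)) (residue-toℕ y y≢∞)

Label : Set
Label = Fin 17 ⊎ (Fin 4 × Fin 51)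

labelling : Fin 221 ↔ Label
labelling = ↔-trans +↔⊎ (↔-refl ⊎-↔ *↔×)

label : Fin 221 → Label
label = Inverse.to labelling

index : Label → Fin 221
index = Inverse.from labelling

shift : Label ↔ Label
shift = rotate 16 ⊎-↔ (↔-refl ×-↔ rotate 50)

σ : Permutation′ 221
σ = ↔-trans labelling (↔-trans shift (↔-sym labelling))

label-σ : ∀ i → label (σ ⟨$⟩ʳ i) ≡ Inverse.to shift (label i)
label-σ i = Inverse.strictlyInverseˡ labelling _

baseBlock : Fin 4 → List ℕ
baseBlock = lookup ((3 ∷ 4 ∷ 13 ∷ 48 ∷ []) ∷ (6 ∷ 8 ∷ 26 ∷ 45 ∷ []) ∷
                    (7 ∷ 10 ∷ 15 ∷ 36 ∷ []) ∷ (1 ∷ 12 ∷ 16 ∷ 39 ∷ []) ∷ [])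

translate : ℕ → List ℕ → List Point
translate s = map (λ a → residue (a + s))

blockList : Label → List Point
blockList (inj₁ j)       = ∞ ∷ translate (toℕ j) (0 ∷ 17 ∷ 34 ∷ [])
blockList (inj₂ (t , s)) = translate (toℕ s) (baseBlock t)

B : Fin 221 → Subset 52
B = fromList ∘ blockList ∘ label

blockSize : ∀ i → ∣ B i ∣ ≡ 4
blockSize = decide (all? λ i → ∣ B i ∣ ℕ.≟ 4)

translate-suc : ∀ s xs → map (ρ ⟨$⟩ʳ_) (translate s xs) ≡ translate (suc s) xs
translate-suc s xs =
  trans (sym (map-∘ xs)) (map-cong (λ a → trans (ρ-residue (a + s)) (cong residue (sym (+-suc a s)))) xs)

translate-mod : ∀ s xs → translate (s % 51) xs ≡ translate s xs
translate-mod s = map-cong λ a → cong (_↑ˡ 1) (mod-cong (a + s % 51) (a + s) 51 (%-absorbʳ a s 51))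

shift-fullBlock : ∀ t s → blockList (Inverse.to shift (inj₂ (t , s))) ≡ map (ρ ⟨$⟩ʳ_) (blockList (inj₂ (t , s)))
shift-fullBlock t s = begin
  translate (toℕ (suc (toℕ s) mod 51)) (baseBlock t) ≡⟨ cong (λ k → translate k (baseBlock t))
                                                           (toℕ-fromℕ< (m%n<n (suc (toℕ s)) 51)) ⟩
  translate (suc (toℕ s) % 51) (baseBlock t)         ≡⟨ translate-mod (suc (toℕ s)) (baseBlock t) ⟩
  translate (suc (toℕ s)) (baseBlock t)              ≡⟨ translate-suc (toℕ s) (baseBlock t) ⟨
  map (ρ ⟨$⟩ʳ_) (translate (toℕ s) (baseBlock t))    ∎
  where open ≡-Reasoning

SameElements : List Point → List Point → Set
SameElements xs ys = xs ⊆ ys × ys ⊆ xs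

-- For short blocks the two lists differ in order once j + 34 wraps around.
shift-blockList : ∀ l → SameElements (map (ρ ⟨$⟩ʳ_) (blockList l)) (blockList (Inverse.to shift l))
shift-blockList (inj₁ j) =
  decide (all? λ j → map (ρ ⟨$⟩ʳ_) (blockList (inj₁ j)) ⊆? blockList (inj₁ (rotate 16 ⟨$⟩ʳ j)) ×-dec
                     blockList (inj₁ (rotate 16 ⟨$⟩ʳ j)) ⊆? map (ρ ⟨$⟩ʳ_) (blockList (inj₁ j))) j
shift-blockList (inj₂ (t , s)) = ⊆-reflexive (sym (shift-fullBlock t s)) , ⊆-reflexive (shift-fullBlock t s)

open BlockFamily B

ρ-maps-blocks : MapsBlocks ρ σ
ρ-maps-blocks i x = forward , backward
  where
  shifted : SameElements (map (ρ ⟨$⟩ʳ_) (blockList (label i))) (blockList (label (σ ⟨$⟩ʳ i)))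
  shifted = subst (SameElements (map (ρ ⟨$⟩ʳ_) (blockList (label i))) ∘ blockList)
                  (sym (label-σ i)) (shift-blockList (label i))
  forward : x ∈ B i → ρ ⟨$⟩ʳ x ∈ B (σ ⟨$⟩ʳ i)
  forward = ∈-fromList⁺ ∘ proj₁ shifted ∘ ∈-map⁺ (ρ ⟨$⟩ʳ_) ∘ ∈-fromList⁻ _
  backward : ρ ⟨$⟩ʳ x ∈ B (σ ⟨$⟩ʳ i) → x ∈ B i
  backward ρx∈ with ∈-map⁻ (ρ ⟨$⟩ʳ_) (proj₂ shifted (∈-fromList⁻ _ ρx∈))
  ... | y , y∈ , ρx≡ρy = ∈-fromList⁺ (subst (_∈ₗ blockList (label i)) (sym (⟨$⟩ʳ-injective ρ ρx≡ρy)) y∈)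

blocksThrough : Point → List Label
blocksThrough x = [ (λ r → inj₁ (toℕ r mod 17) ∷ concatMap (translatesThrough (toℕ r)) (allFin 4))
                  , (λ _ → map inj₁ (allFin 17)) ]′ (splitAt 51 x)
  where
  -- r lies on the translate of base block t by r − a for each a in it; the subtraction in ℤ₅₁
  -- is written r + 51 ∸ a to avoid truncation.
  translatesThrough : ℕ → Fin 4 → List Label
  translatesThrough r t = map (λ a → inj₂ (t , (r + 51 ∸ a) mod 51)) (baseBlock t)

line₀ : Point → Fin 221
line₀ y = index (fromMaybe (inj₁ zero) (find (λ l → residue 0 ∈ₗ? blockList l) (blocksThrough y)))

line₀-covers : ∀ y → y ≢ residue 0 → residue 0 ∈ B (line₀ y) × y ∈ B (line₀ y)
line₀-covers = decide (all? λ y → ¬? (y ≟ residue 0) →-dec (residue 0 ∈ₛ? B (line₀ y) ×-dec y ∈ₛ? B (line₀ y)))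

line₀-unique : ∀ i → residue 0 ∈ B i → ∀ y → y ∈ B i → y ≢ residue 0 → i ≡ line₀ y
line₀-unique = decide (all? λ i → residue 0 ∈ₛ? B i →-dec
                         all? λ y → y ∈ₛ? B i →-dec ¬? (y ≟ residue 0) →-dec i ≟ line₀ y)

uniqueLine-base : ∀ y → y ≢ residue 0 → UniqueLine (residue 0) y
uniqueLine-base y y≢0 = line₀ y , line₀-covers y y≢0 , λ i (0∈ , y∈) → line₀-unique i 0∈ y y∈ y≢0

classOf : Label → Fin 17
classOf (inj₁ j)       = j
classOf (inj₂ (_ , s)) = toℕ s mod 17

classOf-shift : ∀ l → classOf (Inverse.to shift l) ≡ rotate 16 ⟨$⟩ʳ classOf l
classOf-shift (inj₁ j)       = refl
classOf-shift (inj₂ (_ , s)) = begin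
  toℕ (suc (toℕ s) mod 51) mod 17 ≡⟨ mod-cong (toℕ (suc (toℕ s) mod 51)) (suc (toℕ s)) 17
                                       (trans (cong (_% 17) (toℕ-fromℕ< (m%n<n (suc (toℕ s)) 51)))
                                              (m∣n⇒o%n%m≡o%m 17 51 (suc (toℕ s)) (divides 3 refl))) ⟩
  suc (toℕ s) mod 17              ≡⟨ suc-toℕ-mod (toℕ s) 17 ⟨
  suc (toℕ (toℕ s mod 17)) mod 17 ∎
  where open ≡-Reasoning

class : Fin 221 → Fin 17
class = classOf ∘ label

class-σ : ∀ i → class (σ ⟨$⟩ʳ i) ≡ rotate 16 ⟨$⟩ʳ class i
class-σ i = trans (cong classOf (label-σ i)) (classOf-shift (label i))

class₀-block : Point → Fin 221
class₀-block x = index (fromMaybe (inj₁ zero) (find (λ l → classOf l ≟ zero) (blocksThrough x)))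

class₀-block-covers : ∀ x → class (class₀-block x) ≡ zero × x ∈ B (class₀-block x)
class₀-block-covers = decide (all? λ x → class (class₀-block x) ≟ zero ×-dec x ∈ₛ? B (class₀-block x))

class₀-block-unique : ∀ i → class i ≡ zero → ∀ x → x ∈ B i → i ≡ class₀-block x
class₀-block-unique = decide (all? λ i → class i ≟ zero →-dec all? λ x → x ∈ₛ? B i →-dec i ≟ class₀-block x)

uniqueInClass-base : ∀ x → UniqueInClass class zero x
uniqueInClass-base x =
  class₀-block x , class₀-block-covers x , λ i (cᵢ≡0 , x∈) → class₀-block-unique i cᵢ≡0 x x∈

pointwiseAbelianGroup : ∀ {A : Set} {_∙_ : A → A → A} {ε : A} {_⁻¹ : A → A} →
                        IsAbelianGroup _≡_ _∙_ ε _⁻¹ → ℕ → AbelianGroup 0ℓ 0ℓ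
pointwiseAbelianGroup {A} {_∙_} {ε} {_⁻¹} isAbelianGroupᴬ n = record
  { Carrier        = Vec A n
  ; _≈_            = _≡_
  ; _∙_            = zipWith _∙_
  ; ε              = replicate n ε
  ; _⁻¹            = Vec.map _⁻¹
  ; isAbelianGroup = record
    { isGroup = record
      { isMonoid = record
        { isSemigroup = record
          { isMagma = record { isEquivalence = isEquivalence ; ∙-cong = cong₂ (zipWith _∙_) }
          ; assoc   = zipWith-assoc A.assoc }
        ; identity = zipWith-identityˡ A.identityˡ , zipWith-identityʳ A.identityʳ }
      ; inverse = zipWith-inverseˡ A.inverseˡ , zipWith-inverseʳ A.inverseʳ
      ; ⁻¹-cong = cong (Vec.map _⁻¹) }
    ; comm = zipWith-comm A.comm }
  }
  where module A = IsAbelianGroup isAbelianGroupᴬ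

ℤ₂^ : ℕ → AbelianGroup 0ℓ 0ℓ
ℤ₂^ = pointwiseAbelianGroup (CommutativeRing.+-isAbelianGroup xor-∧-commutativeRing)

bits : ∀ n → ℕ → Vec Bool n
bits zero    _ = []
bits (suc n) m = (m % 2 ℕ.≡ᵇ 1) ∷ bits n (m / 2)

embed : Point → Vec Bool 8
embed = bits 8 ∘ lookup codes
  where
  codes : Vec ℕ 52
  codes = 1 ∷ 32 ∷ 116 ∷ 38 ∷ 180 ∷ 3 ∷ 96 ∷ 156 ∷ 106 ∷ 193 ∷ 5 ∷ 160 ∷ 185 ∷ 190 ∷ 94 ∷ 15 ∷ 253 ∷
          214 ∷ 223 ∷ 226 ∷ 17 ∷ 26 ∷ 103 ∷ 124 ∷ 59 ∷ 51 ∷ 46 ∷ 169 ∷ 132 ∷ 77 ∷ 85 ∷ 114 ∷ 230 ∷ 145 ∷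
          215 ∷ 255 ∷ 150 ∷ 55 ∷ 174 ∷ 100 ∷ 28 ∷ 167 ∷ 89 ∷ 239 ∷ 172 ∷ 36 ∷ 244 ∷ 235 ∷ 44 ∷ 233 ∷
          108 ∷ 0 ∷ []

embed-injective : ∀ x y → embed x ≡ embed y → x ≡ y
embed-injective = decide (all? λ x → all? λ y → ≡-decᵛ _≟ᵇ_ (embed x) (embed y) →-dec x ≟ y)

embed-zeroSum : ∀ i → sumSub (ℤ₂^ 8) (B i) embed ≡ replicate 8 false
embed-zeroSum = decide (all? λ i → ≡-decᵛ _≟ᵇ_ (sumSub (ℤ₂^ 8) (B i) embed) (replicate 8 false))

design : Design 52 4
design = record
  { b       = 221
  ; block   = B
  ; blockSz = blockSize
  ; pairs   = uniqueLines-from-base ρ σ ρ-maps-blocks ∞ (residue 0) ρ-∞ (λ ()) ρ-orbit uniqueLine-base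
  }

theorem3p1 : Σ (Design 52 4) λ D → Additive D × OneRotational D × Resolvable D
theorem3p1 =
  design ,
  (ℤ₂^ 8 , embed , embed-injective , embed-zeroSum) ,
  (ρ , (σ , ρ-maps-blocks) , ∞ , ρ-∞ , residue 0 , (λ ()) , ρ-orbit) ,
  (17 , class , uniqueInClasses-from-base ρ σ ρ-maps-blocks class (rotate 16) class-σ
                  zero (rotate-orbit 16) uniqueInClass-base)
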